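{- Let $n,k,m_1,\dots,m_k$ and $t$ be positive integers with $1\le t\le k$, and let $f:\binom{[n]}{2}\to[k]$ be an edge-coloring of $K_n$. If $$\sum_{j=1}^t f_j(x)\ge\bar{R}(m_1,m_2,\ldots,m_t,m_{t+1}-1,\ldots,m_k-1)$$ for some $x\in[n]$, then $\alpha_i(f)\ge m_i$ for some $i\in[k]$.
   Context: $[n]=\{1,\dots,n\}$. For an edge-coloring $f:\binom{[n]}{2}\to[k]$, $\alpha_i(f)$ is the independence number of the graph on $[n]$ whose edges are the pairs of color $i$, and for $x\in[n]$, $f_i(x)=|\{y\in[n]\mid f(\{x,y\})=i\}|$ (the degree of $x$ in color $i$). For non-negative integers $a_1,\dots,a_k$, $\bar{R}(a_1,\dots,a_k)$ is the least positive integer $N$ such that every edge-coloring $g$ of $K_N$ with $k$ colors has some $i$ with $\alpha_i(g)\ge a_i$. -}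

module Defs where

open import Data.Nat using (ℕ; _≤_; _<_; _∸_; _+_)
open import Data.Fin using (Fin; toℕ)
open import Data.Fin.Properties using (_≟_)
open import Data.List using (List; length; filter; map; allFin)
open import Data.Nat.ListAction using (sum)
open import Data.List.Membership.Propositional using (_∈_)
open import Data.List.Relation.Unary.Unique.Propositional using (Unique)
open import Data.Product using (Σ; ∃; _×_)
open import Relation.Binary.PropositionalEquality using (_≡_; _≢_)
open import Relation.Nullary using (¬_; Dec; yes; no)
open import Relation.Nullary.Decidable using (_×-dec_; ¬?)
open import Data.Nat.Properties using (_<?_)

-- The color of the edge {x,y} is col x y; symmetry makes it a function on unordered
-- pairs. Values on the diagonal (x = y) are never used.
record Coloring (n k : ℕ) : Set where
  field
    col : Fin n → Fin n → Fin k
    sym : ∀ x y → col x y ≡ col y x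
open Coloring public

IsIndep : ∀ {n k} → Coloring n k → Fin k → List (Fin n) → Set
IsIndep f i S = Unique S × (∀ {x y} → x ∈ S → y ∈ S → x ≢ y → col f x y ≢ i)

αAtLeast : ∀ {n k} → Coloring n k → Fin k → ℕ → Set
αAtLeast f i m = Σ (List (Fin _)) λ S → IsIndep f i S × m ≤ length S

deg : ∀ {n k} → Coloring n k → Fin k → Fin n → ℕ
deg f i x = length (filter (λ y → ¬? (y ≟ x) ×-dec (col f x y ≟ i)) (allFin _))

-- ∑_{j=1}^{t} f_j(x)   (colors j with toℕ j < t, i.e. the first t colors)
degSum : ∀ {n k} → Coloring n k → ℕ → Fin n → ℕ
degSum {k = k} f t x = sum (map (λ j → deg f j x) (filter (λ j → toℕ j <? t) (allFin k)))

RamseyProp : ∀ {k} → (Fin k → ℕ) → ℕ → Set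
RamseyProp {k} a N = (g : Coloring N k) → ∃ λ i → αAtLeast g i (a i)

IsRbar : ∀ {k} → (Fin k → ℕ) → ℕ → Set
IsRbar a N = 1 ≤ N × RamseyProp a N × (∀ M → 1 ≤ M → RamseyProp a M → N ≤ M)

shiftVec : ∀ {k} → (Fin k → ℕ) → ℕ → (Fin k → ℕ)
shiftVec m t j with toℕ j <? t
... | yes _ = m j
... | no _  = m j ∸ 1

-- The vertices y ≠ x whose edge to x has one of the first t colours number at least
-- R = R̄(m_1,…,m_t,m_{t+1}-1,…,m_k-1), so the colouring restricted to them has, for some i,
-- an independent set of colour i of size m_i if i ≤ t, or of size m_i - 1 if i > t. In the
-- second case no edge from x to that set has colour i, so adding x gives size m_i.
module Submission where

open import Defs
open import Level using (0ℓ)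
open import Data.Nat using (ℕ; _≤_; _<_; _+_; suc; z≤n; s≤s)
open import Data.Nat.Properties using (_<?_; ≤-trans; +-monoʳ-≤; +-suc; m≤n⇒m≤1+n; m≤n+m∸n)
open import Data.Nat.ListAction using (sum)
open import Data.Fin using (Fin; toℕ; inject≤)
open import Data.Fin.Properties using (_≟_; inject≤-injective)
open import Data.List using (List; []; _∷_; length; filter; map; allFin; lookup)
open import Data.List.Properties using (length-map)
open import Data.List.Membership.Propositional using (_∈_)
open import Data.List.Membership.Propositional.Properties using (∈-map⁻; ∈-filter⁻; ∈-lookup)
open import Data.List.Relation.Binary.Subset.Propositional using (_⊆_)
open import Data.List.Relation.Unary.Any using (here; there)
open import Data.List.Relation.Unary.All as All using (All)
open import Data.List.Relation.Unary.AllPairs using (_∷_)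
open import Data.List.Relation.Unary.Unique.Propositional using (Unique)
import Data.List.Relation.Unary.Unique.Propositional.Properties as Unique
open import Data.Product using (Σ; ∃; _×_; _,_; proj₁; proj₂)
open import Data.Empty using (⊥-elim)
open import Function.Definitions using (Injective)
open import Relation.Binary.PropositionalEquality using (_≡_; _≢_; refl; cong; subst; trans) renaming (sym to ≡-sym)
open import Relation.Nullary using (yes; no; contradiction)
open import Relation.Nullary.Decidable using (_×-dec_; ¬?)
open import Relation.Unary using (Pred; Decidable; _∩_; Empty)
import Relation.Unary as U

length-filter-disjoint : ∀ {A : Set} {P P₁ P₂ : Pred A 0ℓ}
  (P? : Decidable P) (P₁? : Decidable P₁) (P₂? : Decidable P₂) →
  P₁ U.⊆ P → P₂ U.⊆ P → Empty (P₁ ∩ P₂) →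
  ∀ ys → length (filter P₁? ys) + length (filter P₂? ys) ≤ length (filter P? ys)
length-filter-disjoint P? P₁? P₂? P₁⇒P P₂⇒P disjoint [] = z≤n
length-filter-disjoint P? P₁? P₂? P₁⇒P P₂⇒P disjoint (y ∷ ys)
  with P₁? y | P₂? y | P? y | length-filter-disjoint P? P₁? P₂? P₁⇒P P₂⇒P disjoint ys
... | yes p₁ | yes p₂ | _      | _  = ⊥-elim (disjoint y (p₁ , p₂))
... | yes p₁ | no _   | no ¬p  | _  = contradiction (P₁⇒P p₁) ¬p
... | no _   | yes p₂ | no ¬p  | _  = contradiction (P₂⇒P p₂) ¬p
... | yes _  | no _   | yes _  | ih = s≤s ih
... | no _   | yes _  | yes _  | ih = subst (_≤ suc (length (filter P? ys))) (≡-sym (+-suc _ _)) (s≤s ih)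
... | no _   | no _   | yes _  | ih = m≤n⇒m≤1+n ih
... | no _   | no _   | no _   | ih = ih

module _ {n k : ℕ} (f : Coloring n k) (x : Fin n) where
  open import Data.List.Membership.DecPropositional (_≟_ {k}) using (_∈?_)

  neighbourVia : List (Fin k) → Fin n → Set
  neighbourVia J y = y ≢ x × col f x y ∈ J

  neighbourVia? : ∀ J → Decidable (neighbourVia J)
  neighbourVia? J y = ¬? (y ≟ x) ×-dec (col f x y ∈? J)

  neighboursVia : List (Fin k) → List (Fin n)
  neighboursVia J = filter (neighbourVia? J) (allFin n)

  unique-neighboursVia : ∀ J → Unique (neighboursVia J)
  unique-neighboursVia J = Unique.filter⁺ (neighbourVia? J) {allFin n} (Unique.allFin⁺ n)

  ∈-neighboursVia⁻ : ∀ {J y} → y ∈ neighboursVia J → neighbourVia J y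
  ∈-neighboursVia⁻ {J} y∈ = proj₂ (∈-filter⁻ (neighbourVia? J) {xs = allFin n} y∈)

  sum-deg≤length-neighboursVia : ∀ J → Unique J →
    sum (map (λ j → deg f j x) J) ≤ length (neighboursVia J)
  sum-deg≤length-neighboursVia [] _ = z≤n
  sum-deg≤length-neighboursVia (j ∷ J) (j∉J ∷ uniqueJ) =
    ≤-trans (+-monoʳ-≤ (deg f j x) (sum-deg≤length-neighboursVia J uniqueJ))
      (length-filter-disjoint (neighbourVia? (j ∷ J))
        (λ y → ¬? (y ≟ x) ×-dec (col f x y ≟ j)) (neighbourVia? J)
        (λ (y≢x , c≡j) → y≢x , here c≡j) (λ (y≢x , c∈J) → y≢x , there c∈J)
        (λ y ((_ , c≡j) , (_ , c∈J)) → All.lookup j∉J (subst (_∈ J) c≡j c∈J) refl)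
        (allFin n))

firstColours : ∀ k → ℕ → List (Fin k)
firstColours k t = filter (λ j → toℕ j <? t) (allFin k)

∈-firstColours⁻ : ∀ {k t j} → j ∈ firstColours k t → toℕ j < t
∈-firstColours⁻ {k} {t} j∈ = proj₂ (∈-filter⁻ (λ j → toℕ j <? t) {xs = allFin k} j∈)

degSum≤length-neighboursVia : ∀ {n k} (f : Coloring n k) t x →
  degSum f t x ≤ length (neighboursVia f x (firstColours k t))
degSum≤length-neighboursVia {k = k} f t x =
  sum-deg≤length-neighboursVia f x (firstColours k t)
    (Unique.filter⁺ (λ j → toℕ j <? t) {allFin k} (Unique.allFin⁺ k))

lookup-injective : ∀ {A : Set} {xs : List A} → Unique xs → Injective _≡_ _≡_ (lookup xs)
lookup-injective {xs = _ ∷ _} _ {Fin.zero} {Fin.zero} _ = refl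
lookup-injective {xs = _ ∷ _} (x∉ ∷ _) {Fin.zero} {Fin.suc j} e = ⊥-elim (All.lookup x∉ (∈-lookup j) e)
lookup-injective {xs = _ ∷ _} (x∉ ∷ _) {Fin.suc i} {Fin.zero} e = ⊥-elim (All.lookup x∉ (∈-lookup i) (≡-sym e))
lookup-injective {xs = _ ∷ _} (_ ∷ u) {Fin.suc i} {Fin.suc j} e = cong Fin.suc (lookup-injective u e)

restrict : ∀ {N n k} → Coloring n k → (Fin N → Fin n) → Coloring N k
restrict f h = record { col = λ a b → col f (h a) (h b) ; sym = λ a b → Coloring.sym f (h a) (h b) }

map-isIndep : ∀ {N n k} (f : Coloring n k) {h : Fin N → Fin n} → Injective _≡_ _≡_ h →
  ∀ {i S} → IsIndep (restrict f h) i S → IsIndep f i (map h S)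
map-isIndep f {h} h-inj {i} {S} (uniqueS , indepS) = Unique.map⁺ h-inj uniqueS , indep
  where
  indep : ∀ {y z} → y ∈ map h S → z ∈ map h S → y ≢ z → col f y z ≢ i
  indep y∈ z∈ y≢z with ∈-map⁻ h y∈ | ∈-map⁻ h z∈
  ... | a , a∈ , refl | b , b∈ , refl = indepS a∈ b∈ (λ a≡b → y≢z (cong h a≡b))

cons-isIndep : ∀ {n k} (f : Coloring n k) {i x S} →
  (∀ {y} → y ∈ S → x ≢ y × col f x y ≢ i) → IsIndep f i S → IsIndep f i (x ∷ S)
cons-isIndep f {i} {x} {S} x-apart (uniqueS , indepS) =
  All.tabulate (λ y∈ → proj₁ (x-apart y∈)) ∷ uniqueS , indep
  where
  indep : ∀ {y z} → y ∈ x ∷ S → z ∈ x ∷ S → y ≢ z → col f y z ≢ i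
  indep (here refl) (here refl) y≢z = contradiction refl y≢z
  indep (here refl) (there z∈) _ = proj₂ (x-apart z∈)
  indep (there y∈) (here refl) _ c≡i = proj₂ (x-apart y∈) (trans (Coloring.sym f x _) c≡i)
  indep (there y∈) (there z∈) y≢z = indepS y∈ z∈ y≢z

embed : ∀ {A : Set} {R} (L : List A) → R ≤ length L → Fin R → A
embed L R≤L a = lookup L (inject≤ a R≤L)

embed-injective : ∀ {A : Set} {R} {L : List A} (R≤L : R ≤ length L) → Unique L →
  Injective _≡_ _≡_ (embed L R≤L)
embed-injective R≤L uniqueL e = inject≤-injective R≤L R≤L _ _ (lookup-injective uniqueL e)

map-embed⊆ : ∀ {A : Set} {R} (L : List A) (R≤L : R ≤ length L) S → map (embed L R≤L) S ⊆ L
map-embed⊆ L R≤L S y∈ with _ , _ , refl ← ∈-map⁻ (embed L R≤L) y∈ = ∈-lookup _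

ramsey-on-sublist : ∀ {n k R} {a : Fin k → ℕ} → RamseyProp a R →
  (f : Coloring n k) (L : List (Fin n)) → Unique L → R ≤ length L →
  ∃ λ i → Σ (List (Fin n)) λ S → (IsIndep f i S × a i ≤ length S) × S ⊆ L
ramsey-on-sublist ramsey f L uniqueL R≤L
  with i , S , indepS , a≤S ← ramsey (restrict f (embed L R≤L)) =
  i , map (embed L R≤L) S ,
  ( map-isIndep f (embed-injective R≤L uniqueL) indepS
  , subst (_ ≤_) (≡-sym (length-map (embed L R≤L) S)) a≤S ) ,
  map-embed⊆ L R≤L S

lemma3p1 : (n k : ℕ) (m : Fin k → ℕ) (t : ℕ) →
    1 ≤ n → (∀ i → 1 ≤ m i) → 1 ≤ t → t ≤ k →
    (f : Coloring n k) →
    (∃ λ x → ∃ λ R → IsRbar (shiftVec m t) R × R ≤ degSum f t x) →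
    ∃ λ i → αAtLeast f i (m i)
lemma3p1 n k m t _ _ _ _ f (x , R , (_ , ramsey , _) , R≤degSum)
  with i , S , (indepS , m′≤S) , S⊆N ←
         ramsey-on-sublist ramsey f (neighboursVia f x (firstColours k t))
           (unique-neighboursVia f x _) (≤-trans R≤degSum (degSum≤length-neighboursVia f t x))
     | toℕ i <? t
-- Abstracting over toℕ i <? t also reduces shiftVec m t i in the type of m′≤S.
... | yes i<t = i , S , indepS , m′≤S
... | no i≮t = i , x ∷ S , cons-isIndep f x-apart indepS ,
                 ≤-trans (m≤n+m∸n (m i) 1) (s≤s m′≤S)
  where
  x-apart : ∀ {y} → y ∈ S → x ≢ y × col f x y ≢ i
  x-apart y∈ with y≢x , c∈ ← ∈-neighboursVia⁻ f x (S⊆N y∈) =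
    (λ x≡y → y≢x (≡-sym x≡y)) , (λ c≡i → i≮t (subst (λ c → toℕ c < t) c≡i (∈-firstColours⁻ c∈)))
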